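{- Let $d\geq 3$, $i\geq 0$, $j\geq 1$, $I=[i,i+d-1]$ and $J=\{0\}\sqcup[j,j+d-3]$, and suppose $J\leq I\setminus\{i+d-1\}$. Set \[ \lambda=\frac{\prod_{k=1}^{d-1}b_{i+k-1,\,j-1}}{\prod_{k=0}^{d-3}b_{j+k-1,\,j-1}}. \] (a) If $2\leq r\leq d-1$, then \[ b^{I\setminus\{i+r-1\}}_J=\lambda\left(\frac{b_{d-2,r-1}}{b_{i+r-1,j-1}}+\frac{b_{d-2,r-2}}{b_{i+r-2,j-1}}\right). \] (b) If $r=1$ or $r=d$, then \[ b^{I\setminus\{i\}}_J=\frac{\lambda}{b_{i,j-1}}\quad\text{and}\quad b^{I\setminus\{i+d-1\}}_J=\frac{\lambda}{b_{i+d-2,j-1}}. \]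
   Context: For integers $p,q\geq 0$, $b_{p,q}=\binom{p}{q}$, with $b_{p,q}=0$ if $q>p$. For $k\leq l$, $[k,l]=\{k,\ldots,l\}$. For finite sets $I=\{i_1<\cdots<i_m\}$, $J=\{j_1<\cdots<j_m\}$ of non-negative integers, $b^I_J$ is the determinant of the $m\times m$ matrix with $(r,s)$ entry $b_{i_r,j_s}$, and $J\leq I$ means $j_k\leq i_k$ for all $k$. -}

module Defs where

open import Data.Nat as ℕ using (ℕ; zero; suc; _+_; _∸_; _<ᵇ_; _≟_; _≤_)
open import Data.Nat.Combinatorics using (_C_)
open import Data.Integer as ℤ using (ℤ; +_; -_)
open import Data.Rational as ℚ using (ℚ; mkℚ; _÷_)
open import Data.List using (List; []; _∷_; map; upTo; filter; length)
open import Data.List.Relation.Binary.Pointwise using (Pointwise)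
open import Data.Bool using (if_then_else_)
open import Relation.Nullary using (¬?)

-- b_{p,q} = binomial coefficient (zero when q > p, as in the stdlib)
b : ℕ → ℕ → ℕ
b p q = p C q

∑ : ℕ → (ℕ → ℤ) → ℤ
∑ zero f = + 0
∑ (suc n) f = ∑ n f ℤ.+ f n

sign : ℕ → ℤ
sign zero = + 1
sign (suc k) = - sign k

-- skip k s : the s-th index after deleting column k
skip : ℕ → ℕ → ℕ
skip k s = if s <ᵇ k then s else suc s

det : ℕ → (ℕ → ℕ → ℤ) → ℤ
det zero M = + 1
det (suc m) M = ∑ (suc m) (λ k → sign k ℤ.* (M 0 k ℤ.* det m (λ r s → M (suc r) (skip k s))))

-- k-th entry of a list (default 0 out of range)
nth : List ℕ → ℕ → ℕ
nth [] _ = 0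
nth (x ∷ xs) zero = x
nth (x ∷ xs) (suc k) = nth xs k

-- finite sets of naturals are represented as strictly increasing lists.
-- b^I_J = det (b_{i_r, j_s})
bMinor : List ℕ → List ℕ → ℤ
bMinor I J = det (length I) (λ r s → + b (nth I r) (nth J s))

-- [a, a+n-1] as an increasing list (n elements)
range : ℕ → ℕ → List ℕ
range a n = map (λ k → a + k) (upTo n)

remove : List ℕ → ℕ → List ℕ
remove I x = filter (λ y → ¬? (y ≟ x)) I

-- J ≤ I : same size and j_k ≤ i_k for all k
_≤ˢ_ : List ℕ → List ℕ → Set
J ≤ˢ I = Pointwise _≤_ J I

toℚ : ℕ → ℚ
toℚ n = (+ n) ℚ./ 1

toℚℤ : ℤ → ℚ
toℚℤ z = z ℚ./ 1

-- total division (only ever applied to nonzero denominators in the statement)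
_÷'_ : ℚ → ℚ → ℚ
p ÷' mkℚ (+ zero) d c = ℚ.0ℚ
p ÷' q@(mkℚ (+ suc n) d c) = p ÷ q
p ÷' q@(mkℚ ℤ.-[1+ n ] d c) = p ÷ q

{-# OPTIONS --safe #-}
module Submission where

-- Subtracting from every row of b^{I∖{i+r-1}}_J its predecessor turns the first column (all ones,
-- as 0 ∈ J) into a unit vector, and by Pascal's rule the other entries become binomial coefficients
-- with lower index decreased by one. Only the row straddling the gap at i+r-1 has two Pascal terms; by
-- linearity it splits the minor into two minors with consecutive columns [j-1, j+d-4], one for each of
-- the two ways of closing the gap. A minor with rows ρ₀ < … < ρₙ₋₁ in [a, a+n] ∖ {a+t} and columns
-- [c, c+n-1] equals C(n,t) ∏ₖ b(ρₖ, c) / ∏ₖ b(c+k, c): by the absorption identity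
-- (k+1) C(n+1,k+1) = (n+1) C(n,k), scaling its columns and rows relates it to the same minor with
-- a and c lowered by one, and for c = 0 the row-difference step yields Pascal's recursion for C(n,t).

open import Defs
open import Data.Nat as ℕ using (ℕ; zero; suc; _+_; _∸_; _≤_; _<_; z≤n; s≤s; z<s; _<ᵇ_; _≡ᵇ_)
import Data.Nat.Properties as ℕP
open import Data.Nat.Combinatorics using (_C_; nCk+nC[k+1]≡[n+1]C[k+1]; nC1≡n; nCn≡1)
open import Data.Nat.Coprimality using (1-coprimeTo) renaming (sym to Coprime-sym)
open import Data.Nat.ListAction using (product)
import Data.Nat.Tactic.RingSolver as ℕSolver
open import Data.Integer as ℤ using (ℤ; +_)
import Data.Integer.Properties as ℤP
open import Data.Integer.Tactic.RingSolver using (solve-∀)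
open import Data.Rational using (ℚ; mkℚ; _*_)
import Data.Rational as ℚ
import Data.Rational.Properties as ℚP
open import Data.Rational.Solver using () renaming (module +-*-Solver to ℚSolver)
open import Algebra.Properties.CommutativeSemigroup ℤP.+-commutativeSemigroup
  using () renaming (interchange to +-interchange)
open import Algebra.Properties.CommutativeSemigroup ℤP.*-commutativeSemigroup
  using () renaming (interchange to *-interchange; x∙yz≈y∙xz to *-swapˡ)
open import Data.Bool using (true; false; if_then_else_)
open import Data.List using (List; _∷_; map; upTo; applyUpTo; length)
import Data.List.Properties as LP
open import Data.List.Relation.Binary.Pointwise using (_∷_)
open import Data.Product using (_×_; _,_)
open import Data.Sum using (inj₁; inj₂)
open import Function using (_∘_)
open import Relation.Binary.Definitions using (tri<; tri≈; tri>)
open import Relation.Binary.PropositionalEquality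
  using (_≡_; _≢_; refl; sym; trans; cong; cong₂; subst; subst₂; module ≡-Reasoning)
open import Relation.Nullary using (contradiction; ¬?)

open ≡-Reasoning

∑-cong : ∀ n {f g : ℕ → ℤ} → (∀ k → k < n → f k ≡ g k) → ∑ n f ≡ ∑ n g
∑-cong zero    f≗g = refl
∑-cong (suc n) f≗g =
  cong₂ ℤ._+_ (∑-cong n (λ k k<n → f≗g k (ℕP.m<n⇒m<1+n k<n))) (f≗g n ℕP.≤-refl)

∑-zero : ∀ n {f : ℕ → ℤ} → (∀ k → k < n → f k ≡ + 0) → ∑ n f ≡ + 0
∑-zero zero    f≗0 = refl
∑-zero (suc n) f≗0 =
  cong₂ ℤ._+_ (∑-zero n (λ k k<n → f≗0 k (ℕP.m<n⇒m<1+n k<n))) (f≗0 n ℕP.≤-refl)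

∑-distrib-+ : ∀ n (f g : ℕ → ℤ) → ∑ n (λ k → f k ℤ.+ g k) ≡ ∑ n f ℤ.+ ∑ n g
∑-distrib-+ zero    f g = refl
∑-distrib-+ (suc n) f g = trans (cong (ℤ._+ (f n ℤ.+ g n)) (∑-distrib-+ n f g))
                                (+-interchange (∑ n f) (∑ n g) (f n) (g n))

*-distribˡ-∑ : ∀ n a (f : ℕ → ℤ) → ∑ n (λ k → a ℤ.* f k) ≡ a ℤ.* ∑ n f
*-distribˡ-∑ zero    a f = sym (ℤP.*-zeroʳ a)
*-distribˡ-∑ (suc n) a f = trans (cong (ℤ._+ a ℤ.* f n) (*-distribˡ-∑ n a f))
                                 (sym (ℤP.*-distribˡ-+ a (∑ n f) (f n)))

neg-distrib-∑ : ∀ n (f : ℕ → ℤ) → ∑ n (λ k → ℤ.- f k) ≡ ℤ.- ∑ n f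
neg-distrib-∑ zero    f = refl
neg-distrib-∑ (suc n) f = trans (cong (ℤ._+ ℤ.- f n) (neg-distrib-∑ n f))
                                (sym (ℤP.neg-distrib-+ (∑ n f) (f n)))

∑-unfoldˡ : ∀ n (f : ℕ → ℤ) → ∑ (suc n) f ≡ f 0 ℤ.+ ∑ n (f ∘ suc)
∑-unfoldˡ zero    f = ℤP.+-comm (+ 0) (f 0)
∑-unfoldˡ (suc n) f = trans (cong (ℤ._+ f (suc n)) (∑-unfoldˡ n f))
                            (ℤP.+-assoc (f 0) (∑ n (f ∘ suc)) (f (suc n)))

∑-split : ∀ m n (f : ℕ → ℤ) → ∑ (m + n) f ≡ ∑ m f ℤ.+ ∑ n (λ l → f (m + l))
∑-split m zero    f = trans (cong (λ k → ∑ k f) (ℕP.+-identityʳ m)) (sym (ℤP.+-identityʳ (∑ m f)))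
∑-split m (suc n) f = begin
  ∑ (m + suc n) f                                  ≡⟨ cong (λ k → ∑ k f) (ℕP.+-suc m n) ⟩
  ∑ (m + n) f ℤ.+ f (m + n)                        ≡⟨ cong (ℤ._+ f (m + n)) (∑-split m n f) ⟩
  ∑ m f ℤ.+ ∑ n (λ l → f (m + l)) ℤ.+ f (m + n)    ≡⟨ ℤP.+-assoc (∑ m f) _ _ ⟩
  ∑ m f ℤ.+ ∑ (suc n) (λ l → f (m + l))            ∎

∑-triangle : ∀ N (G : ℕ → ℕ → ℤ) →
  ∑ N (λ p → ∑ (N ∸ suc p) (λ l → G p (suc (p + l)))) ≡ ∑ N (λ q → ∑ q (λ p → G p q))
∑-triangle zero    G = refl
∑-triangle (suc N) G = begin
  ∑ N (λ p → ∑ (N ∸ p) (row p)) ℤ.+ ∑ (N ∸ N) (row N)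
    ≡⟨ cong₂ ℤ._+_ (∑-cong N peel) (cong (λ k → ∑ k (row N)) (ℕP.n∸n≡0 N)) ⟩
  ∑ N (λ p → ∑ (N ∸ suc p) (row p) ℤ.+ G p N) ℤ.+ + 0
    ≡⟨ ℤP.+-identityʳ _ ⟩
  ∑ N (λ p → ∑ (N ∸ suc p) (row p) ℤ.+ G p N)
    ≡⟨ ∑-distrib-+ N _ _ ⟩
  ∑ N (λ p → ∑ (N ∸ suc p) (row p)) ℤ.+ ∑ N (λ p → G p N)
    ≡⟨ cong (ℤ._+ ∑ N (λ p → G p N)) (∑-triangle N G) ⟩
  ∑ N (λ q → ∑ q (λ p → G p q)) ℤ.+ ∑ N (λ p → G p N) ∎
  where
  row : ℕ → ℕ → ℤ
  row p l = G p (suc (p + l))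
  peel : ∀ p → p < N → ∑ (N ∸ p) (row p) ≡ ∑ (N ∸ suc p) (row p) ℤ.+ G p N
  peel p p<N = begin
    ∑ (N ∸ p) (row p)
      ≡⟨ cong (λ k → ∑ k (row p)) (ℕP.+-∸-assoc 1 p<N) ⟩
    ∑ (N ∸ suc p) (row p) ℤ.+ row p (N ∸ suc p)
      ≡⟨ cong (λ q → ∑ (N ∸ suc p) (row p) ℤ.+ G p q) (ℕP.m+[n∸m]≡n p<N) ⟩
    ∑ (N ∸ suc p) (row p) ℤ.+ G p N ∎

-- Determinants

if-<ᵇ-yes : ∀ {A : Set} {r k} {x y : A} → r < k → (if r <ᵇ k then x else y) ≡ x
if-<ᵇ-yes {r = r} {k} r<k with r <ᵇ k | ℕP.<⇒<ᵇ r<k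
... | true | _ = refl

if-<ᵇ-no : ∀ {A : Set} {r k} {x y : A} → k ≤ r → (if r <ᵇ k then x else y) ≡ y
if-<ᵇ-no {r = r} {k} k≤r with r <ᵇ k | ℕP.<ᵇ⇒< r k
... | false | _   = refl
... | true  | r<k = contradiction (r<k _) (ℕP.≤⇒≯ k≤r)

skip-< : ∀ {k s} → s < k → skip k s ≡ s
skip-< = if-<ᵇ-yes

skip-≥ : ∀ {k s} → k ≤ s → skip k s ≡ suc s
skip-≥ = if-<ᵇ-no

skip-suc-suc : ∀ k s → skip (suc k) (suc s) ≡ suc (skip k s)
skip-suc-suc k s with s <ᵇ k
... | true  = refl
... | false = refl

skip-<-suc : ∀ k {s n} → s < n → skip k s < suc n
skip-<-suc k {s} s<n with s <ᵇ k
... | true  = ℕP.m<n⇒m<1+n s<n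
... | false = s≤s s<n

skip-skip : ∀ {k l} s → k ≤ l → skip k (skip l s) ≡ skip (suc l) (skip k s)
skip-skip {zero}  {l}     s       _         = sym (skip-suc-suc l s)
skip-skip {suc k} {suc l} zero    _         = refl
skip-skip {suc k} {suc l} (suc s) (s≤s k≤l) = begin
  skip (suc k) (skip (suc l) (suc s))        ≡⟨ cong (skip (suc k)) (skip-suc-suc l s) ⟩
  skip (suc k) (suc (skip l s))              ≡⟨ skip-suc-suc k (skip l s) ⟩
  suc (skip k (skip l s))                    ≡⟨ cong suc (skip-skip s k≤l) ⟩
  suc (skip (suc l) (skip k s))              ≡⟨ skip-suc-suc (suc l) (skip k s) ⟨
  skip (suc (suc l)) (suc (skip k s))        ≡⟨ cong (skip (suc (suc l))) (skip-suc-suc k s) ⟨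
  skip (suc (suc l)) (skip (suc k) (suc s))  ∎

skip-suc-≢ : ∀ {t r} → r ≢ t → skip (suc t) r ≡ skip t r
skip-suc-≢ {t} {r} r≢t with ℕP.<-cmp r t
... | tri< r<t _ _ = trans (skip-< (ℕP.m<n⇒m<1+n r<t)) (sym (skip-< r<t))
... | tri≈ _ r≡t _ = contradiction r≡t r≢t
... | tri> _ _ t<r = trans (skip-≥ t<r) (sym (skip-≥ (ℕP.<⇒≤ t<r)))

skip-consecutive : ∀ {t r} → suc r ≢ t → skip t (suc r) ≡ suc (skip t r)
skip-consecutive {t} {r} 1+r≢t with ℕP.<-cmp (suc r) t
... | tri< 1+r<t _ _ = trans (skip-< 1+r<t) (cong suc (sym (skip-< (ℕP.<-trans (ℕP.n<1+n r) 1+r<t))))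
... | tri≈ _ 1+r≡t _ = contradiction 1+r≡t 1+r≢t
... | tri> _ _ t<1+r = trans (skip-≥ (ℕP.<⇒≤ t<1+r)) (cong suc (sym (skip-≥ (ℕP.≤-pred t<1+r))))

Matrix : Set
Matrix = ℕ → ℕ → ℤ

minor : ℕ → Matrix → Matrix
minor k M r s = M (suc r) (skip k s)

laplaceTerm : ℕ → Matrix → ℕ → ℤ
laplaceTerm n M k = sign k ℤ.* (M 0 k ℤ.* det n (minor k M))

laplaceTerm-entry0 : ∀ n M k → M 0 k ≡ + 0 → laplaceTerm n M k ≡ + 0
laplaceTerm-entry0 n M k M₀ₖ≡0 rewrite M₀ₖ≡0 = ℤP.*-zeroʳ (sign k)

laplaceTerm-minor0 : ∀ n M k → det n (minor k M) ≡ + 0 → laplaceTerm n M k ≡ + 0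
laplaceTerm-minor0 n M k minor≡0 rewrite minor≡0 | ℤP.*-zeroʳ (M 0 k) = ℤP.*-zeroʳ (sign k)

det-cong : ∀ n {M N : Matrix} → (∀ r s → r < n → s < n → M r s ≡ N r s) → det n M ≡ det n N
det-cong zero    M≗N = refl
det-cong (suc n) M≗N = ∑-cong (suc n) λ k k<1+n →
  cong₂ (λ x y → sign k ℤ.* (x ℤ.* y)) (M≗N 0 k (s≤s z≤n) k<1+n)
        (det-cong n λ r s r<n s<n → M≗N (suc r) (skip k s) (s≤s r<n) (skip-<-suc k s<n))

Π : ℕ → (ℕ → ℤ) → ℤ
Π zero    h = + 1
Π (suc n) h = h 0 ℤ.* Π n (h ∘ suc)

Π-cong : ∀ n {f g : ℕ → ℤ} → (∀ k → f k ≡ g k) → Π n f ≡ Π n g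
Π-cong zero    f≗g = refl
Π-cong (suc n) f≗g = cong₂ ℤ._*_ (f≗g 0) (Π-cong n (f≗g ∘ suc))

Π-distrib-* : ∀ n (f g : ℕ → ℤ) → Π n (λ k → f k ℤ.* g k) ≡ Π n f ℤ.* Π n g
Π-distrib-* zero    f g = refl
Π-distrib-* (suc n) f g = trans (cong (f 0 ℤ.* g 0 ℤ.*_) (Π-distrib-* n (f ∘ suc) (g ∘ suc)))
                                (*-interchange (f 0) (g 0) _ _)

Π-one : ∀ n → Π n (λ _ → + 1) ≡ + 1
Π-one zero    = refl
Π-one (suc n) = cong (+ 1 ℤ.*_) (Π-one n)

Π-nonZero : ∀ n (h : ℕ → ℤ) → (∀ k → ℤ.NonZero (h k)) → ℤ.NonZero (Π n h)
Π-nonZero zero    h h≢0 = _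
Π-nonZero (suc n) h h≢0 =
  ℤP.i*j≢0 (h 0) (Π n (h ∘ suc)) {{h≢0 0}} {{Π-nonZero n (h ∘ suc) (h≢0 ∘ suc)}}

Π-skip : ∀ n k (h : ℕ → ℤ) → k ≤ n → Π (suc n) h ≡ h k ℤ.* Π n (h ∘ skip k)
Π-skip n       zero    h _         = refl
Π-skip (suc n) (suc k) h (s≤s k≤n) = begin
  h 0 ℤ.* Π (suc n) (h ∘ suc)                        ≡⟨ cong (h 0 ℤ.*_) (Π-skip n k (h ∘ suc) k≤n) ⟩
  h 0 ℤ.* (h (suc k) ℤ.* Π n (h ∘ suc ∘ skip k))      ≡⟨ *-swapˡ (h 0) (h (suc k)) _ ⟩
  h (suc k) ℤ.* (h 0 ℤ.* Π n (h ∘ suc ∘ skip k))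
    ≡⟨ cong (λ p → h (suc k) ℤ.* (h 0 ℤ.* p)) (Π-cong n (cong h ∘ sym ∘ skip-suc-suc k)) ⟩
  h (suc k) ℤ.* Π (suc n) (h ∘ skip (suc k))          ∎

private
  pull-scale : ∀ σ a m p d → σ ℤ.* (a ℤ.* m ℤ.* (p ℤ.* d)) ≡ (a ℤ.* p) ℤ.* (σ ℤ.* (m ℤ.* d))
  pull-scale = solve-∀

det-scaleRows : ∀ n (g : ℕ → ℤ) M → det n (λ r s → g r ℤ.* M r s) ≡ Π n g ℤ.* det n M
det-scaleRows zero    g M = refl
det-scaleRows (suc n) g M = begin
  ∑ (suc n) (laplaceTerm n (λ r s → g r ℤ.* M r s))
    ≡⟨ ∑-cong (suc n) (λ k _ → scaled k) ⟩
  ∑ (suc n) (λ k → Π (suc n) g ℤ.* laplaceTerm n M k)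
    ≡⟨ *-distribˡ-∑ (suc n) (Π (suc n) g) (laplaceTerm n M) ⟩
  Π (suc n) g ℤ.* det (suc n) M ∎
  where
  scaled : ∀ k → laplaceTerm n (λ r s → g r ℤ.* M r s) k ≡ Π (suc n) g ℤ.* laplaceTerm n M k
  scaled k = trans (cong (λ x → sign k ℤ.* (g 0 ℤ.* M 0 k ℤ.* x)) (det-scaleRows n (g ∘ suc) (minor k M)))
                   (pull-scale (sign k) (g 0) (M 0 k) _ _)

det-scaleColumns : ∀ n (h : ℕ → ℤ) M → det n (λ r s → h s ℤ.* M r s) ≡ Π n h ℤ.* det n M
det-scaleColumns zero    h M = refl
det-scaleColumns (suc n) h M = begin
  ∑ (suc n) (laplaceTerm n (λ r s → h s ℤ.* M r s))
    ≡⟨ ∑-cong (suc n) scaled ⟩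
  ∑ (suc n) (λ k → Π (suc n) h ℤ.* laplaceTerm n M k)
    ≡⟨ *-distribˡ-∑ (suc n) (Π (suc n) h) (laplaceTerm n M) ⟩
  Π (suc n) h ℤ.* det (suc n) M ∎
  where
  scaled : ∀ k → k < suc n → laplaceTerm n (λ r s → h s ℤ.* M r s) k ≡ Π (suc n) h ℤ.* laplaceTerm n M k
  scaled k (s≤s k≤n) = begin
    sign k ℤ.* (h k ℤ.* M 0 k ℤ.* det n (λ r s → h (skip k s) ℤ.* minor k M r s))
      ≡⟨ cong (λ x → sign k ℤ.* (h k ℤ.* M 0 k ℤ.* x)) (det-scaleColumns n (h ∘ skip k) (minor k M)) ⟩
    sign k ℤ.* (h k ℤ.* M 0 k ℤ.* (Π n (h ∘ skip k) ℤ.* det n (minor k M)))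
      ≡⟨ pull-scale (sign k) (h k) (M 0 k) _ _ ⟩
    h k ℤ.* Π n (h ∘ skip k) ℤ.* laplaceTerm n M k
      ≡⟨ cong (ℤ._* laplaceTerm n M k) (Π-skip n k h k≤n) ⟨
    Π (suc n) h ℤ.* laplaceTerm n M k ∎

RowsAgreeExcept : ℕ → Matrix → Matrix → Set
RowsAgreeExcept k M N = ∀ r → r ≢ k → ∀ s → M r s ≡ N r s

minor-agreeExcept : ∀ {k M N} q → RowsAgreeExcept (suc k) M N →
                    RowsAgreeExcept k (minor q M) (minor q N)
minor-agreeExcept q M≈N r r≢k s = M≈N (suc r) (r≢k ∘ ℕP.suc-injective) (skip q s)

det-additive-laplace : ∀ n {M A B} →
  (∀ q → M 0 q ℤ.* det n (minor q M) ≡ A 0 q ℤ.* det n (minor q A) ℤ.+ B 0 q ℤ.* det n (minor q B)) →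
  det (suc n) M ≡ det (suc n) A ℤ.+ det (suc n) B
det-additive-laplace n {M} {A} {B} split = begin
  ∑ (suc n) (laplaceTerm n M)
    ≡⟨ ∑-cong (suc n) (λ q _ → trans (cong (sign q ℤ.*_) (split q)) (ℤP.*-distribˡ-+ (sign q) _ _)) ⟩
  ∑ (suc n) (λ q → laplaceTerm n A q ℤ.+ laplaceTerm n B q)
    ≡⟨ ∑-distrib-+ (suc n) (laplaceTerm n A) (laplaceTerm n B) ⟩
  det (suc n) A ℤ.+ det (suc n) B ∎

det-additiveRow : ∀ n k {M A B} → k < n → RowsAgreeExcept k A M → RowsAgreeExcept k B M →
                  (∀ s → M k s ≡ A k s ℤ.+ B k s) → det n M ≡ det n A ℤ.+ det n B
det-additiveRow (suc n) zero {M} {A} {B} _ A≈M B≈M M₀≡A₀+B₀ =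
  det-additive-laplace n {M} {A} {B} λ q → begin
    M 0 q ℤ.* det n (minor q M)
      ≡⟨ cong (ℤ._* det n (minor q M)) (M₀≡A₀+B₀ q) ⟩
    (A 0 q ℤ.+ B 0 q) ℤ.* det n (minor q M)
      ≡⟨ ℤP.*-distribʳ-+ (det n (minor q M)) (A 0 q) (B 0 q) ⟩
    A 0 q ℤ.* det n (minor q M) ℤ.+ B 0 q ℤ.* det n (minor q M)
      ≡⟨ cong₂ (λ x y → A 0 q ℤ.* x ℤ.+ B 0 q ℤ.* y) (sameMinor q A≈M) (sameMinor q B≈M) ⟩
    A 0 q ℤ.* det n (minor q A) ℤ.+ B 0 q ℤ.* det n (minor q B) ∎
  where
  sameMinor : ∀ q {X} → RowsAgreeExcept 0 X M → det n (minor q M) ≡ det n (minor q X)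
  sameMinor q X≈M = det-cong n λ r s _ _ → sym (X≈M (suc r) (λ ()) (skip q s))
det-additiveRow (suc n) (suc k) {M} {A} {B} (s≤s k<n) A≈M B≈M Mₖ≡Aₖ+Bₖ =
  det-additive-laplace n {M} {A} {B} λ q → begin
    M 0 q ℤ.* det n (minor q M)
      ≡⟨ cong (M 0 q ℤ.*_) (det-additiveRow n k k<n (minor-agreeExcept q A≈M) (minor-agreeExcept q B≈M)
                                                     (Mₖ≡Aₖ+Bₖ ∘ skip q)) ⟩
    M 0 q ℤ.* (det n (minor q A) ℤ.+ det n (minor q B))
      ≡⟨ ℤP.*-distribˡ-+ (M 0 q) _ _ ⟩
    M 0 q ℤ.* det n (minor q A) ℤ.+ M 0 q ℤ.* det n (minor q B)
      ≡⟨ cong₂ (λ x y → x ℤ.* det n (minor q A) ℤ.+ y ℤ.* det n (minor q B))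
               (sym (A≈M 0 (λ ()) q)) (sym (B≈M 0 (λ ()) q)) ⟩
    A 0 q ℤ.* det n (minor q A) ℤ.+ B 0 q ℤ.* det n (minor q B) ∎

-- Expanding along rows 0 and 1, the term for columns (k, l) with l < k cancels the one for (l, k - 1).
det-equalFirstRows : ∀ n {M} → (∀ s → M 0 s ≡ M 1 s) → det (suc (suc n)) M ≡ + 0
det-equalFirstRows n {M} M₀≡M₁ = begin
  ∑ N (laplaceTerm (suc n) M)
    ≡⟨ ∑-cong N (λ k _ → expand k) ⟩
  ∑ N (λ k → ∑ (suc n) (T k))
    ≡⟨ ∑-cong N split ⟩
  ∑ N (λ k → ∑ k (λ l → F l k) ℤ.+ ∑ (N ∸ suc k) (λ l → ℤ.- F k (suc (k + l))))
    ≡⟨ ∑-distrib-+ N _ _ ⟩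
  lower ℤ.+ ∑ N (λ k → ∑ (N ∸ suc k) (λ l → ℤ.- F k (suc (k + l))))
    ≡⟨ cong (λ x → lower ℤ.+ x) (trans (∑-cong N (λ k _ → neg-distrib-∑ (N ∸ suc k) _))
                                       (neg-distrib-∑ N _)) ⟩
  lower ℤ.+ ℤ.- ∑ N (λ k → ∑ (N ∸ suc k) (λ l → F k (suc (k + l))))
    ≡⟨ cong (λ x → lower ℤ.+ ℤ.- x) (∑-triangle N F) ⟩
  lower ℤ.+ ℤ.- lower
    ≡⟨ ℤP.+-inverseʳ lower ⟩
  + 0 ∎
  where
  N = suc (suc n)
  v = M 0
  T : ℕ → ℕ → ℤ
  T k l = sign k ℤ.* v k ℤ.* (sign l ℤ.* v (skip k l)) ℤ.* det n (minor l (minor k M))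
  F : ℕ → ℕ → ℤ
  F p q = sign p ℤ.* v p ℤ.* (sign q ℤ.* v q) ℤ.* det n (minor p (minor q M))
  lower = ∑ N (λ q → ∑ q (λ p → F p q))

  reassoc : ∀ a b c d e → a ℤ.* b ℤ.* (c ℤ.* (d ℤ.* e)) ≡ a ℤ.* b ℤ.* (c ℤ.* d) ℤ.* e
  reassoc = solve-∀
  flip-sign : ∀ a c d e → a ℤ.* (c ℤ.* d) ℤ.* e ≡ ℤ.- (a ℤ.* (ℤ.- c ℤ.* d) ℤ.* e)
  flip-sign = solve-∀

  expand : ∀ k → laplaceTerm (suc n) M k ≡ ∑ (suc n) (T k)
  expand k = begin
    sign k ℤ.* (v k ℤ.* ∑ (suc n) (laplaceTerm n (minor k M)))
      ≡⟨ ℤP.*-assoc (sign k) (v k) _ ⟨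
    sign k ℤ.* v k ℤ.* ∑ (suc n) (laplaceTerm n (minor k M))
      ≡⟨ *-distribˡ-∑ (suc n) (sign k ℤ.* v k) _ ⟨
    ∑ (suc n) (λ l → sign k ℤ.* v k ℤ.* laplaceTerm n (minor k M) l)
      ≡⟨ ∑-cong (suc n) (λ l _ → trans (reassoc (sign k) (v k) (sign l) _ _) (second-row l)) ⟩
    ∑ (suc n) (T k) ∎
    where
    second-row : ∀ l → sign k ℤ.* v k ℤ.* (sign l ℤ.* M 1 (skip k l)) ℤ.* det n (minor l (minor k M))
                     ≡ T k l
    second-row l = cong (λ x → sign k ℤ.* v k ℤ.* (sign l ℤ.* x) ℤ.* det n (minor l (minor k M)))
                        (sym (M₀≡M₁ (skip k l)))

  below : ∀ k l → l < k → T k l ≡ F l k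
  below k l l<k rewrite skip-< l<k =
    cong (ℤ._* det n (minor l (minor k M))) (ℤP.*-comm (sign k ℤ.* v k) _)

  above : ∀ k l → T k (k + l) ≡ ℤ.- F k (suc (k + l))
  above k l rewrite skip-≥ (ℕP.m≤m+n k l) =
    trans (cong (λ x → sign k ℤ.* v k ℤ.* (sign (k + l) ℤ.* v (suc (k + l))) ℤ.* x) minors-agree)
          (flip-sign (sign k ℤ.* v k) (sign (k + l)) _ _)
    where
    minors-agree : det n (minor (k + l) (minor k M)) ≡ det n (minor k (minor (suc (k + l)) M))
    minors-agree = det-cong n λ r s _ _ → cong (M (suc (suc r))) (skip-skip s (ℕP.m≤m+n k l))

  split : ∀ k → k < N →
          ∑ (suc n) (T k) ≡ ∑ k (λ l → F l k) ℤ.+ ∑ (N ∸ suc k) (λ l → ℤ.- F k (suc (k + l)))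
  split k (s≤s k≤1+n) = begin
    ∑ (suc n) (T k)                                   ≡⟨ cong (λ m → ∑ m (T k)) (ℕP.m+[n∸m]≡n k≤1+n) ⟨
    ∑ (k + (suc n ∸ k)) (T k)                         ≡⟨ ∑-split k (suc n ∸ k) (T k) ⟩
    ∑ k (T k) ℤ.+ ∑ (suc n ∸ k) (λ l → T k (k + l))
      ≡⟨ cong₂ ℤ._+_ (∑-cong k (below k)) (∑-cong (suc n ∸ k) (λ l _ → above k l)) ⟩
    ∑ k (λ l → F l k) ℤ.+ ∑ (N ∸ suc k) (λ l → ℤ.- F k (suc (k + l))) ∎

det-equalAdjacentRows : ∀ n k {M} → suc k < n → (∀ s → M k s ≡ M (suc k) s) → det n M ≡ + 0
det-equalAdjacentRows (suc (suc n)) zero    {M} _           Mₖ≡Mₖ₊₁ = det-equalFirstRows n {M} Mₖ≡Mₖ₊₁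
det-equalAdjacentRows (suc n)       (suc k) {M} (s≤s 1+k<n) Mₖ≡Mₖ₊₁ = ∑-zero (suc n) λ q _ →
  laplaceTerm-minor0 n M q (det-equalAdjacentRows n k 1+k<n (Mₖ≡Mₖ₊₁ ∘ skip q))

replaceRow : ℕ → (ℕ → ℤ) → Matrix → Matrix
replaceRow k v M r s = if r ≡ᵇ k then v s else M r s

replaceRow-agreeExcept : ∀ k v M → RowsAgreeExcept k (replaceRow k v M) M
replaceRow-agreeExcept k v M r r≢k s with r ≡ᵇ k | ℕP.≡ᵇ⇒≡ r k
... | false | _   = refl
... | true  | r≡k = contradiction (r≡k _) r≢k

replaceRow-row : ∀ k v M s → replaceRow k v M k s ≡ v s
replaceRow-row k v M s with k ≡ᵇ k | ℕP.≡⇒≡ᵇ k k refl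
... | true  | _  = refl
... | false | ()

det-subtractPreviousRow : ∀ n k {M N} → suc k < n → RowsAgreeExcept (suc k) N M →
                          (∀ s → N (suc k) s ≡ M (suc k) s ℤ.- M k s) → det n N ≡ det n M
det-subtractPreviousRow n k {M} {N} 1+k<n N≈M Nₖ₊₁≡Mₖ₊₁-Mₖ = begin
  det n N                 ≡⟨ ℤP.+-identityʳ (det n N) ⟨
  det n N ℤ.+ + 0         ≡⟨ cong (λ x → det n N ℤ.+ x) (det-equalAdjacentRows n k 1+k<n Rₖ≡Rₖ₊₁) ⟨
  det n N ℤ.+ det n R     ≡⟨ det-additiveRow n (suc k) 1+k<n N≈M (replaceRow-agreeExcept (suc k) (M k) M)
                                             Mₖ₊₁≡Nₖ₊₁+Rₖ₊₁ ⟨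
  det n M                 ∎
  where
  R = replaceRow (suc k) (M k) M
  Rₖ≡Rₖ₊₁ : ∀ s → R k s ≡ R (suc k) s
  Rₖ≡Rₖ₊₁ s = trans (replaceRow-agreeExcept (suc k) (M k) M k (ℕP.<⇒≢ (ℕP.n<1+n k)) s)
                    (sym (replaceRow-row (suc k) (M k) M s))
  minus-plus : ∀ a b → a ≡ a ℤ.- b ℤ.+ b
  minus-plus = solve-∀
  Mₖ₊₁≡Nₖ₊₁+Rₖ₊₁ : ∀ s → M (suc k) s ≡ N (suc k) s ℤ.+ R (suc k) s
  Mₖ₊₁≡Nₖ₊₁+Rₖ₊₁ s = trans (minus-plus (M (suc k) s) (M k s))
                           (sym (cong₂ ℤ._+_ (Nₖ₊₁≡Mₖ₊₁-Mₖ s) (replaceRow-row (suc k) (M k) M s)))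

telescopeFrom : ℕ → Matrix → Matrix
telescopeFrom k M r s = if r <ᵇ k then M r s else M r s ℤ.- M (r ∸ 1) s

det-telescopeFrom-step : ∀ n k M → suc k < n →
                         det n (telescopeFrom (suc k) M) ≡ det n (telescopeFrom (suc (suc k)) M)
det-telescopeFrom-step n k M 1+k<n =
  det-subtractPreviousRow n k {telescopeFrom (suc (suc k)) M} 1+k<n agree row
  where
  agree : RowsAgreeExcept (suc k) (telescopeFrom (suc k) M) (telescopeFrom (suc (suc k)) M)
  agree r r≢1+k s with ℕP.<-cmp r (suc k)
  ... | tri< r<1+k _ _ = trans (if-<ᵇ-yes r<1+k) (sym (if-<ᵇ-yes (ℕP.m<n⇒m<1+n r<1+k)))
  ... | tri≈ _ r≡1+k _ = contradiction r≡1+k r≢1+k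
  ... | tri> _ _ 1+k<r = trans (if-<ᵇ-no (ℕP.<⇒≤ 1+k<r)) (sym (if-<ᵇ-no 1+k<r))
  row : ∀ s → telescopeFrom (suc k) M (suc k) s
            ≡ telescopeFrom (suc (suc k)) M (suc k) s ℤ.- telescopeFrom (suc (suc k)) M k s
  row s = trans (if-<ᵇ-no {r = suc k} ℕP.≤-refl)
                (sym (cong₂ ℤ._-_ (if-<ᵇ-yes (ℕP.n<1+n (suc k)))
                                  (if-<ᵇ-yes (ℕP.m<n⇒m<1+n (ℕP.n<1+n k)))))

det-telescopeFrom : ∀ g k n M → g + suc k ≡ n → det n (telescopeFrom (suc k) M) ≡ det n M
det-telescopeFrom zero    k n M refl = det-cong n {telescopeFrom (suc k) M} λ r s r<n _ → if-<ᵇ-yes r<n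
det-telescopeFrom (suc g) k n M g+1+k≡n = trans
  (det-telescopeFrom-step n k M (subst (suc k <_) g+1+k≡n (ℕP.m<n+m (suc k) z<s)))
  (det-telescopeFrom g (suc k) n M (trans (ℕP.+-suc g (suc k)) g+1+k≡n))

det-zeroFirstColumn : ∀ {n M} → 0 < n → (∀ r → M r 0 ≡ + 0) → det n M ≡ + 0
det-zeroFirstColumn {suc n} {M} _ col≡0 = ∑-zero (suc n) term
  where
  term : ∀ k → k < suc n → laplaceTerm n M k ≡ + 0
  term zero    _         = laplaceTerm-entry0 n M 0 (col≡0 0)
  term (suc k) (s≤s k<n) =
    laplaceTerm-minor0 n M (suc k) (det-zeroFirstColumn (ℕP.≤-trans (s≤s z≤n) k<n) (col≡0 ∘ suc))

det-firstColumnCollapse : ∀ n {M} → (∀ r → M (suc r) 0 ≡ + 0) →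
                          det (suc n) M ≡ M 0 0 ℤ.* det n (minor 0 M)
det-firstColumnCollapse n {M} below≡0 = begin
  ∑ (suc n) (laplaceTerm n M)                        ≡⟨ ∑-unfoldˡ n (laplaceTerm n M) ⟩
  laplaceTerm n M 0 ℤ.+ ∑ n (laplaceTerm n M ∘ suc)  ≡⟨ cong (λ x → laplaceTerm n M 0 ℤ.+ x) (∑-zero n rest) ⟩
  laplaceTerm n M 0 ℤ.+ + 0                          ≡⟨ ℤP.+-identityʳ _ ⟩
  + 1 ℤ.* (M 0 0 ℤ.* det n (minor 0 M))              ≡⟨ ℤP.*-identityˡ _ ⟩
  M 0 0 ℤ.* det n (minor 0 M)                        ∎
  where
  rest : ∀ k → k < n → laplaceTerm n M (suc k) ≡ + 0
  rest k k<n = laplaceTerm-minor0 n M (suc k)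
                 (det-zeroFirstColumn {M = minor (suc k) M} (ℕP.≤-trans (s≤s z≤n) k<n) below≡0)

rowDifferences : Matrix → Matrix
rowDifferences M r s = M (suc r) (suc s) ℤ.- M r (suc s)

det-firstColumnOnes : ∀ n M → (∀ r → M r 0 ≡ + 1) → det (suc n) M ≡ det n (rowDifferences M)
det-firstColumnOnes n M col≡1 = begin
  det (suc n) M                       ≡⟨ det-telescopeFrom n 0 (suc n) M (ℕP.+-comm n 1) ⟨
  det (suc n) (telescopeFrom 1 M)     ≡⟨ det-firstColumnCollapse n {telescopeFrom 1 M} below≡0 ⟩
  M 0 0 ℤ.* det n (rowDifferences M)  ≡⟨ cong (ℤ._* det n (rowDifferences M)) (col≡1 0) ⟩
  + 1 ℤ.* det n (rowDifferences M)    ≡⟨ ℤP.*-identityˡ _ ⟩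
  det n (rowDifferences M)            ∎
  where
  below≡0 : ∀ r → telescopeFrom 1 M (suc r) 0 ≡ + 0
  below≡0 r rewrite col≡1 (suc r) | col≡1 r = refl

-- Binomial coefficients

[k+1]*[n+1]C[k+1]≡[n+1]*nCk : ∀ n k → suc k ℕ.* (suc n C suc k) ≡ suc n ℕ.* (n C k)
[k+1]*[n+1]C[k+1]≡[n+1]*nCk n       zero    =
  trans (ℕP.*-identityˡ (suc n C 1)) (trans (nC1≡n (suc n)) (sym (ℕP.*-identityʳ (suc n))))
[k+1]*[n+1]C[k+1]≡[n+1]*nCk zero    (suc k) = ℕP.*-zeroʳ (suc (suc k))
[k+1]*[n+1]C[k+1]≡[n+1]*nCk (suc n) (suc k) = begin
  (2 + k) ℕ.* (suc (suc n) C suc (suc k))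
    ≡⟨ cong ((2 + k) ℕ.*_) (nCk+nC[k+1]≡[n+1]C[k+1] (suc n) (suc k)) ⟨
  (2 + k) ℕ.* (suc n C suc k + suc n C suc (suc k))
    ≡⟨ regroup k (suc n C suc k) (suc n C suc (suc k)) ⟩
  suc n C suc k + ((1 + k) ℕ.* (suc n C suc k) + (2 + k) ℕ.* (suc n C suc (suc k)))
    ≡⟨ cong₂ (λ x y → suc n C suc k + (x + y)) ([k+1]*[n+1]C[k+1]≡[n+1]*nCk n k)
                                                ([k+1]*[n+1]C[k+1]≡[n+1]*nCk n (suc k)) ⟩
  suc n C suc k + ((1 + n) ℕ.* (n C k) + (1 + n) ℕ.* (n C suc k))
    ≡⟨ cong (λ x → suc n C suc k + x) (ℕP.*-distribˡ-+ (1 + n) (n C k) (n C suc k)) ⟨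
  suc n C suc k + (1 + n) ℕ.* (n C k + n C suc k)
    ≡⟨ cong (λ x → suc n C suc k + (1 + n) ℕ.* x) (nCk+nC[k+1]≡[n+1]C[k+1] n k) ⟩
  (2 + n) ℕ.* (suc n C suc k) ∎
  where
  regroup : ∀ k x y → (2 + k) ℕ.* (x + y) ≡ x + ((1 + k) ℕ.* x + (2 + k) ℕ.* y)
  regroup = ℕSolver.solve-∀

0<nCk : ∀ {n k} → k ≤ n → 0 < n C k
0<nCk {n}     {zero}  _         = s≤s z≤n
0<nCk {suc n} {suc k} (s≤s k≤n) = subst (0 <_) (nCk+nC[k+1]≡[n+1]C[k+1] n k)
                                        (ℕP.<-≤-trans (0<nCk k≤n) (ℕP.m≤m+n (n C k) (n C suc k)))

nCk-nonZero : ∀ {n k} → k ≤ n → ℕ.NonZero (n C k)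
nCk-nonZero = ℕ.>-nonZero ∘ 0<nCk

pascal-ℤ : ∀ x y → + b (suc x) (suc y) ℤ.- + b x (suc y) ≡ + b x y
pascal-ℤ x y = begin
  + b (suc x) (suc y) ℤ.- + b x (suc y)
    ≡⟨ cong (λ z → + z ℤ.- + b x (suc y)) (nCk+nC[k+1]≡[n+1]C[k+1] x y) ⟨
  + (b x y + b x (suc y)) ℤ.- + b x (suc y)
    ≡⟨ cong (ℤ._- + b x (suc y)) (ℤP.pos-+ (b x y) (b x (suc y))) ⟩
  + b x y ℤ.+ + b x (suc y) ℤ.- + b x (suc y)
    ≡⟨ plus-minus (+ b x y) (+ b x (suc y)) ⟩
  + b x y ∎
  where
  plus-minus : ∀ p q → p ℤ.+ q ℤ.- q ≡ p
  plus-minus = solve-∀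

pascal₂-ℤ : ∀ x y → + b (suc (suc x)) (suc y) ℤ.- + b x (suc y) ≡ + b (suc x) y ℤ.+ + b x y
pascal₂-ℤ x y =
  trans (sym (ℤP.+-minus-telescope (+ b (suc (suc x)) (suc y)) (+ b (suc x) (suc y)) (+ b x (suc y))))
        (cong₂ ℤ._+_ (pascal-ℤ (suc x) y) (pascal-ℤ x y))

absorption-ℤ : ∀ n k → + suc k ℤ.* + b (suc n) (suc k) ≡ + suc n ℤ.* + b n k
absorption-ℤ n k = trans (sym (ℤP.pos-* (suc k) _))
                         (trans (cong +_ ([k+1]*[n+1]C[k+1]≡[n+1]*nCk n k)) (ℤP.pos-* (suc n) _))

-- Binomial determinants

binomialMatrix : (ℕ → ℕ) → (ℕ → ℕ) → Matrix
binomialMatrix ρ κ r s = + b (ρ r) (κ s)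

det-binomialMatrix-absorb : ∀ n ρ κ →
  det n (binomialMatrix (suc ∘ ρ) (suc ∘ κ)) ℤ.* Π n (λ s → + suc (κ s))
    ≡ Π n (λ r → + suc (ρ r)) ℤ.* det n (binomialMatrix ρ κ)
det-binomialMatrix-absorb n ρ κ = begin
  det n (binomialMatrix (suc ∘ ρ) (suc ∘ κ)) ℤ.* Π n h
    ≡⟨ ℤP.*-comm _ (Π n h) ⟩
  Π n h ℤ.* det n (binomialMatrix (suc ∘ ρ) (suc ∘ κ))
    ≡⟨ det-scaleColumns n h _ ⟨
  det n (λ r s → h s ℤ.* binomialMatrix (suc ∘ ρ) (suc ∘ κ) r s)
    ≡⟨ det-cong n (λ r s _ _ → absorption-ℤ (ρ r) (κ s)) ⟩
  det n (λ r s → g r ℤ.* binomialMatrix ρ κ r s)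
    ≡⟨ det-scaleRows n g _ ⟩
  Π n g ℤ.* det n (binomialMatrix ρ κ) ∎
  where
  h g : ℕ → ℤ
  h s = + suc (κ s)
  g r = + suc (ρ r)

Π-binomial-absorb : ∀ n c (ρ : ℕ → ℕ) →
  Π n (λ k → + b (suc (ρ k)) (suc c)) ℤ.* Π n (λ _ → + suc c)
    ≡ Π n (λ k → + suc (ρ k)) ℤ.* Π n (λ k → + b (ρ k) c)
Π-binomial-absorb n c ρ = begin
  Π n (λ k → + b (suc (ρ k)) (suc c)) ℤ.* Π n (λ _ → + suc c)  ≡⟨ Π-distrib-* n _ _ ⟨
  Π n (λ k → + b (suc (ρ k)) (suc c) ℤ.* + suc c)               ≡⟨ Π-cong n absorb ⟩
  Π n (λ k → + suc (ρ k) ℤ.* + b (ρ k) c)                      ≡⟨ Π-distrib-* n _ _ ⟩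
  Π n (λ k → + suc (ρ k)) ℤ.* Π n (λ k → + b (ρ k) c)          ∎
  where
  absorb : ∀ k → + b (suc (ρ k)) (suc c) ℤ.* + suc c ≡ + suc (ρ k) ℤ.* + b (ρ k) c
  absorb k = trans (ℤP.*-comm (+ b (suc (ρ k)) (suc c)) (+ suc c)) (absorption-ℤ (ρ k) c)

gapRange : ℕ → ℕ → ℕ → ℕ
gapRange a t r = a + skip t r

cols₀ : ℕ → ℕ → ℕ
cols₀ c zero    = 0
cols₀ c (suc s) = suc c + s

-- det n (Bin a c t) is the paper's b^I_J for I = [a, a+n] ∖ {a+t} and J = [c, c+n-1], and
-- det (suc n) (Bin₀ a c t) the one for I = [a, a+n+1] ∖ {a+t} and J = {0} ⊔ [c+1, c+n].
Bin Bin₀ : ℕ → ℕ → ℕ → Matrix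
Bin  a c t = binomialMatrix (gapRange a t) (λ s → c + s)
Bin₀ a c t = binomialMatrix (gapRange a t) (cols₀ c)

Bin-suc-agree : ∀ a c t {r} s → r ≢ t → Bin a c (suc t) r s ≡ Bin a c t r s
Bin-suc-agree a c t s r≢t = cong (λ x → + b (a + x) (c + s)) (skip-suc-≢ r≢t)

rowDifferences-Bin₀ : ∀ a c t {r} s → suc r ≢ t → rowDifferences (Bin₀ a c t) r s ≡ Bin a c t r s
rowDifferences-Bin₀ a c t {r} s 1+r≢t = begin
  + b (a + skip t (suc r)) (suc (c + s)) ℤ.- + b (gapRange a t r) (suc (c + s))
    ≡⟨ cong (λ x → + b x (suc (c + s)) ℤ.- + b (gapRange a t r) (suc (c + s)))
            (trans (cong (λ x → a + x) (skip-consecutive 1+r≢t)) (ℕP.+-suc a (skip t r))) ⟩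
  + b (suc (gapRange a t r)) (suc (c + s)) ℤ.- + b (gapRange a t r) (suc (c + s))
    ≡⟨ pascal-ℤ (gapRange a t r) (c + s) ⟩
  Bin a c t r s ∎

det-Bin₀-gapFirst : ∀ n a c → det (suc n) (Bin₀ a c 0) ≡ det n (Bin a c 0)
det-Bin₀-gapFirst n a c = trans (det-firstColumnOnes n (Bin₀ a c 0) (λ _ → refl))
                                (det-cong n λ r s _ _ → rowDifferences-Bin₀ a c 0 s ℕP.1+n≢0)

det-Bin₀-gapLast : ∀ n a c → det (suc n) (Bin₀ a c (suc n)) ≡ det n (Bin a c n)
det-Bin₀-gapLast n a c = trans (det-firstColumnOnes n (Bin₀ a c (suc n)) (λ _ → refl))
                               (det-cong n λ r s r<n _ → row r s r<n)
  where
  row : ∀ r s → r < n → rowDifferences (Bin₀ a c (suc n)) r s ≡ Bin a c n r s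
  row r s r<n = trans (rowDifferences-Bin₀ a c (suc n) s (ℕP.<⇒≢ (s≤s r<n)))
                      (Bin-suc-agree a c n s (ℕP.<⇒≢ r<n))

det-Bin₀-gapInside : ∀ n a c t → t < n →
                     det (suc n) (Bin₀ a c (suc t)) ≡ det n (Bin a c t) ℤ.+ det n (Bin a c (suc t))
det-Bin₀-gapInside n a c t t<n = trans (det-firstColumnOnes n (Bin₀ a c (suc t)) (λ _ → refl))
                                       (det-additiveRow n t t<n below above middle)
  where
  below : RowsAgreeExcept t (Bin a c t) (rowDifferences (Bin₀ a c (suc t)))
  below r r≢t s = sym (trans (rowDifferences-Bin₀ a c (suc t) s (r≢t ∘ ℕP.suc-injective))
                             (Bin-suc-agree a c t s r≢t))
  above : RowsAgreeExcept t (Bin a c (suc t)) (rowDifferences (Bin₀ a c (suc t)))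
  above r r≢t s = sym (rowDifferences-Bin₀ a c (suc t) s (r≢t ∘ ℕP.suc-injective))
  gap-above : a + skip (suc t) (suc t) ≡ suc (suc (a + t))
  gap-above = trans (cong (λ x → a + x) (skip-≥ ℕP.≤-refl))
                    (trans (ℕP.+-suc a (suc t)) (cong suc (ℕP.+-suc a t)))
  gap-below : a + skip (suc t) t ≡ a + t
  gap-below = cong (λ x → a + x) (skip-< (ℕP.n<1+n t))
  gap-at : a + skip t t ≡ suc (a + t)
  gap-at = trans (cong (λ x → a + x) (skip-≥ ℕP.≤-refl)) (ℕP.+-suc a t)
  middle : ∀ s → rowDifferences (Bin₀ a c (suc t)) t s ≡ Bin a c t t s ℤ.+ Bin a c (suc t) t s
  middle s = begin
    + b (a + skip (suc t) (suc t)) (suc (c + s)) ℤ.- + b (a + skip (suc t) t) (suc (c + s))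
      ≡⟨ cong₂ (λ x y → + b x (suc (c + s)) ℤ.- + b y (suc (c + s))) gap-above gap-below ⟩
    + b (suc (suc (a + t))) (suc (c + s)) ℤ.- + b (a + t) (suc (c + s))
      ≡⟨ pascal₂-ℤ (a + t) (c + s) ⟩
    + b (suc (a + t)) (c + s) ℤ.+ + b (a + t) (c + s)
      ≡⟨ cong₂ (λ x y → + b x (c + s) ℤ.+ + b y (c + s)) gap-at gap-below ⟨
    Bin a c t t s ℤ.+ Bin a c (suc t) t s ∎

det-Bin≡det-Bin₀ : ∀ n a t → det n (Bin a 0 t) ≡ det n (Bin₀ a 0 t)
det-Bin≡det-Bin₀ n a t = det-cong n same
  where
  same : ∀ r s → r < n → s < n → Bin a 0 t r s ≡ Bin₀ a 0 t r s
  same r zero    _ _ = refl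
  same r (suc s) _ _ = refl

det-Bin-0 : ∀ n a t → t ≤ n → det n (Bin a 0 t) ≡ + (n C t)
det-Bin-0 zero    a zero    _ = refl
det-Bin-0 (suc n) a zero    _ = begin
  det (suc n) (Bin a 0 0)   ≡⟨ det-Bin≡det-Bin₀ (suc n) a 0 ⟩
  det (suc n) (Bin₀ a 0 0)  ≡⟨ det-Bin₀-gapFirst n a 0 ⟩
  det n (Bin a 0 0)         ≡⟨ det-Bin-0 n a 0 z≤n ⟩
  + 1                       ∎
det-Bin-0 (suc n) a (suc t) (s≤s t≤n) with ℕP.m≤n⇒m<n∨m≡n t≤n
... | inj₁ t<n = begin
  det (suc n) (Bin a 0 (suc t))                  ≡⟨ det-Bin≡det-Bin₀ (suc n) a (suc t) ⟩
  det (suc n) (Bin₀ a 0 (suc t))                 ≡⟨ det-Bin₀-gapInside n a 0 t t<n ⟩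
  det n (Bin a 0 t) ℤ.+ det n (Bin a 0 (suc t))
    ≡⟨ cong₂ ℤ._+_ (det-Bin-0 n a t t≤n) (det-Bin-0 n a (suc t) t<n) ⟩
  + (n C t) ℤ.+ + (n C suc t)                    ≡⟨ ℤP.pos-+ (n C t) (n C suc t) ⟨
  + (n C t + n C suc t)                          ≡⟨ cong +_ (nCk+nC[k+1]≡[n+1]C[k+1] n t) ⟩
  + (suc n C suc t)                              ∎
... | inj₂ refl = begin
  det (suc n) (Bin a 0 (suc n))   ≡⟨ det-Bin≡det-Bin₀ (suc n) a (suc n) ⟩
  det (suc n) (Bin₀ a 0 (suc n))  ≡⟨ det-Bin₀-gapLast n a 0 ⟩
  det n (Bin a 0 n)               ≡⟨ det-Bin-0 n a n ℕP.≤-refl ⟩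
  + (n C n)                       ≡⟨ cong +_ (trans (nCn≡1 n) (sym (nCn≡1 (suc n)))) ⟩
  + (suc n C suc n)               ∎

-- Induction on c. By absorption, scaling column s of Bin (a+1) (c+1) t by c+s+1 gives Bin a c t with
-- row r scaled by a + skip t r + 1; the common factor (c+1)ⁿ is cancelled at the end.
det-Bin : ∀ n c a t → c ≤ a → t ≤ n →
  det n (Bin a c t) ℤ.* Π n (λ k → + b (c + k) c) ≡ + (n C t) ℤ.* Π n (λ k → + b (gapRange a t k) c)
det-Bin n zero    a       t _         t≤n = begin
  det n (Bin a 0 t) ℤ.* Π n (λ _ → + 1)  ≡⟨ cong₂ ℤ._*_ (det-Bin-0 n a t t≤n) (Π-one n) ⟩
  + (n C t) ℤ.* + 1                      ≡⟨ cong (+ (n C t) ℤ.*_) (Π-one n) ⟨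
  + (n C t) ℤ.* Π n (λ _ → + 1)          ∎
det-Bin n (suc c) (suc a) t (s≤s c≤a) t≤n =
  ℤP.*-cancelʳ-≡ _ _ u {{Π-nonZero n (λ _ → + suc c) (λ _ → _)}} (begin
    D′ ℤ.* P′ ℤ.* u           ≡⟨ ℤP.*-assoc D′ P′ u ⟩
    D′ ℤ.* (P′ ℤ.* u)         ≡⟨ cong (D′ ℤ.*_) (Π-binomial-absorb n c (λ k → c + k)) ⟩
    D′ ℤ.* (S ℤ.* P)          ≡⟨ ℤP.*-assoc D′ S P ⟨
    D′ ℤ.* S ℤ.* P            ≡⟨ cong (ℤ._* P) (det-binomialMatrix-absorb n (gapRange a t) (λ s → c + s)) ⟩
    X ℤ.* D ℤ.* P             ≡⟨ ℤP.*-assoc X D P ⟩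
    X ℤ.* (D ℤ.* P)           ≡⟨ cong (X ℤ.*_) (det-Bin n c a t c≤a t≤n) ⟩
    X ℤ.* (+ (n C t) ℤ.* Q)   ≡⟨ *-swapˡ X (+ (n C t)) Q ⟩
    + (n C t) ℤ.* (X ℤ.* Q)   ≡⟨ cong (+ (n C t) ℤ.*_) (Π-binomial-absorb n c (gapRange a t)) ⟨
    + (n C t) ℤ.* (Q′ ℤ.* u)  ≡⟨ ℤP.*-assoc (+ (n C t)) Q′ u ⟨
    + (n C t) ℤ.* Q′ ℤ.* u    ∎)
  where
  u  = Π n (λ _ → + suc c)
  D′ = det n (Bin (suc a) (suc c) t)
  D  = det n (Bin a c t)
  P′ = Π n (λ k → + b (suc c + k) (suc c))
  P  = Π n (λ k → + b (c + k) c)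
  Q′ = Π n (λ k → + b (gapRange (suc a) t k) (suc c))
  Q  = Π n (λ k → + b (gapRange a t k) c)
  S  = Π n (λ s → + suc (c + s))
  X  = Π n (λ r → + suc (gapRange a t r))

nth-applyUpTo : ∀ {N} f {r} → r < N → nth (applyUpTo f N) r ≡ f r
nth-applyUpTo {suc N} f {zero}  _         = refl
nth-applyUpTo {suc N} f {suc r} (s≤s r<N) = nth-applyUpTo (f ∘ suc) r<N

applyUpTo-cong : ∀ N {g h : ℕ → ℕ} → (∀ k → g k ≡ h k) → applyUpTo g N ≡ applyUpTo h N
applyUpTo-cong N {g} {h} g≗h =
  trans (sym (LP.map-upTo g N)) (trans (LP.map-cong g≗h (upTo N)) (LP.map-upTo h N))

remove-∉ : ∀ N f x → (∀ k → f k ≢ x) → remove (applyUpTo f N) x ≡ applyUpTo f N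
remove-∉ zero    f x f≢x = refl
remove-∉ (suc N) f x f≢x = trans (LP.filter-accept (λ y → ¬? (y ℕ.≟ x)) (f≢x 0))
                                 (cong (f 0 ∷_) (remove-∉ N (f ∘ suc) x (f≢x ∘ suc)))

remove-applyUpTo : ∀ N f t → (∀ {k} → f k ≡ f t → k ≡ t) → t ≤ N →
                   remove (applyUpTo f (suc N)) (f t) ≡ applyUpTo (f ∘ skip t) N
remove-applyUpTo N       f zero    f-inj _ =
  trans (LP.filter-reject (λ y → ¬? (y ℕ.≟ f 0)) (λ f₀≢f₀ → f₀≢f₀ refl))
        (remove-∉ N (f ∘ suc) (f 0) (λ k → ℕP.1+n≢0 ∘ f-inj))
remove-applyUpTo (suc N) f (suc t) f-inj (s≤s t≤N) =
  trans (LP.filter-accept (λ y → ¬? (y ℕ.≟ f (suc t))) (ℕP.0≢1+n ∘ f-inj))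
        (cong (f 0 ∷_) (trans (remove-applyUpTo N (f ∘ suc) t (ℕP.suc-injective ∘ f-inj) t≤N)
                              (applyUpTo-cong N (cong f ∘ sym ∘ skip-suc-suc t))))

remove-range : ∀ i N t → t ≤ N → remove (range i (suc N)) (i + t) ≡ applyUpTo (gapRange i t) N
remove-range i N t t≤N = trans (cong (λ I → remove I (i + t)) (LP.map-upTo (λ k → i + k) (suc N)))
                               (remove-applyUpTo N (λ k → i + k) t (ℕP.+-cancelˡ-≡ i _ _) t≤N)

nth-cols₀ : ∀ n c {s} → s < suc n → nth (0 ∷ range (suc c) n) s ≡ cols₀ c s
nth-cols₀ n c {zero}  _         = refl
nth-cols₀ n c {suc s} (s≤s s<n) = trans (cong (λ J → nth J s) (LP.map-upTo (λ k → suc c + k) n))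
                                        (nth-applyUpTo (λ k → suc c + k) s<n)

bMinor-Bin₀ : ∀ n i c t → t ≤ suc n →
  bMinor (remove (range i (suc (suc n))) (i + t)) (0 ∷ range (suc c) n) ≡ det (suc n) (Bin₀ i c t)
bMinor-Bin₀ n i c t t≤1+n = begin
  bMinor (remove (range i (suc (suc n))) (i + t)) J
    ≡⟨ cong (λ I → bMinor I J) (remove-range i (suc n) t t≤1+n) ⟩
  det (length I) (binomialMatrix (nth I) (nth J))
    ≡⟨ cong (λ k → det k (binomialMatrix (nth I) (nth J))) (LP.length-applyUpTo (gapRange i t) (suc n)) ⟩
  det (suc n) (binomialMatrix (nth I) (nth J))
    ≡⟨ det-cong (suc n) (λ r s r<1+n s<1+n → cong₂ (λ x y → + b x y) (nth-applyUpTo (gapRange i t) r<1+n)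
                                                                   (nth-cols₀ n c s<1+n)) ⟩
  det (suc n) (Bin₀ i c t) ∎
  where
  I = applyUpTo (gapRange i t) (suc n)
  J = 0 ∷ range (suc c) n

≤ˢ-gapLast⇒c≤a : ∀ n a c →
  (0 ∷ range (suc c) (suc n)) ≤ˢ remove (range a (3 + n)) (a + (3 + n) ∸ 1) → c ≤ a
≤ˢ-gapLast⇒c≤a n a c J≤I = second-entries (subst ((0 ∷ range (suc c) (suc n)) ≤ˢ_) I≡gapRange J≤I)
  where
  I≡gapRange : remove (range a (3 + n)) (a + (3 + n) ∸ 1) ≡ applyUpTo (gapRange a (2 + n)) (2 + n)
  I≡gapRange = trans (cong (remove (range a (3 + n))) (ℕP.+-∸-assoc a (s≤s z≤n)))
                     (remove-range a (2 + n) (2 + n) ℕP.≤-refl)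
  second-entries : (0 ∷ range (suc c) (suc n)) ≤ˢ applyUpTo (gapRange a (2 + n)) (2 + n) → c ≤ a
  second-entries (_ ∷ c+1≤a+1 ∷ _) =
    ℕP.≤-pred (subst₂ _≤_ (cong suc (ℕP.+-identityʳ c)) (ℕP.+-comm a 1) c+1≤a+1)

+product≡Π : ∀ N (f : ℕ → ℕ) → + product (map f (upTo N)) ≡ Π N (λ k → + f k)
+product≡Π N f = trans (cong (λ xs → + product xs) (LP.map-upTo f N)) (applyUpTo-Π N f)
  where
  applyUpTo-Π : ∀ N f → + product (applyUpTo f N) ≡ Π N (λ k → + f k)
  applyUpTo-Π zero    f = refl
  applyUpTo-Π (suc N) f = trans (ℤP.pos-* (f 0) _) (cong (+ f 0 ℤ.*_) (applyUpTo-Π N (f ∘ suc)))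

toℚℤ≡mkℚ : ∀ z → toℚℤ z ≡ mkℚ z 0 (Coprime-sym (1-coprimeTo ℤ.∣ z ∣))
toℚℤ≡mkℚ (+ n)      = ℚP.normalize-coprime (Coprime-sym (1-coprimeTo n))
toℚℤ≡mkℚ ℤ.-[1+ n ] = cong ℚ.-_ (ℚP.normalize-coprime (Coprime-sym (1-coprimeTo (suc n))))

toℚℤ-+ : ∀ x y → toℚℤ (x ℤ.+ y) ≡ toℚℤ x ℚ.+ toℚℤ y
toℚℤ-+ x y rewrite toℚℤ≡mkℚ x | toℚℤ≡mkℚ y =
  cong (ℚ._/ 1) (sym (cong₂ ℤ._+_ (ℤP.*-identityʳ x) (ℤP.*-identityʳ y)))

toℚℤ-* : ∀ x y → toℚℤ (x ℤ.* y) ≡ toℚℤ x * toℚℤ y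
toℚℤ-* x y rewrite toℚℤ≡mkℚ x | toℚℤ≡mkℚ y = refl

toℚℤ-nonZero : ∀ z .{{_ : ℤ.NonZero z}} → ℚ.NonZero (toℚℤ z)
toℚℤ-nonZero ℤ.+[1+ n ] rewrite toℚℤ≡mkℚ ℤ.+[1+ n ] = _
toℚℤ-nonZero ℤ.-[1+ n ] rewrite toℚℤ≡mkℚ ℤ.-[1+ n ] = _

toℚ-nCk-nonZero : ∀ {x k} → k ≤ x → ℚ.NonZero (toℚ (x C k))
toℚ-nCk-nonZero {x} {k} k≤x = toℚℤ-nonZero (+ (x C k)) {{nCk-nonZero k≤x}}

÷'≡*1/ : ∀ p q .{{_ : ℚ.NonZero q}} → p ÷' q ≡ p * ℚ.1/ q
÷'≡*1/ p (mkℚ ℤ.+[1+ n ] d c) = refl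
÷'≡*1/ p (mkℚ ℤ.-[1+ n ] d c) = refl

*-1÷' : ∀ p q .{{_ : ℚ.NonZero q}} → p * (ℚ.1ℚ ÷' q) ≡ p ÷' q
*-1÷' p q = trans (cong (p *_) (trans (÷'≡*1/ ℚ.1ℚ q) (ℚP.*-identityˡ (ℚ.1/ q)))) (sym (÷'≡*1/ p q))

-- _÷'_ has the default fixity, binding tighter than _*_.
≡-÷'-* : ∀ x p c q f .{{_ : ℚ.NonZero p}} .{{_ : ℚ.NonZero f}} →
         x * p ≡ c * q → x ≡ ((f * q) ÷' p) * (c ÷' f)
≡-÷'-* x p c q f xp≡cq = begin
  x                                ≡⟨ ℚP.*-identityʳ x ⟨
  x * ℚ.1ℚ                         ≡⟨ cong (x *_) (ℚP.*-inverseʳ p) ⟨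
  x * (p * ℚ.1/ p)                 ≡⟨ ℚP.*-assoc x p (ℚ.1/ p) ⟨
  x * p * ℚ.1/ p                   ≡⟨ cong (_* ℚ.1/ p) xp≡cq ⟩
  c * q * ℚ.1/ p                   ≡⟨ ℚP.*-identityˡ _ ⟨
  ℚ.1ℚ * (c * q * ℚ.1/ p)          ≡⟨ cong (_* (c * q * ℚ.1/ p)) (ℚP.*-inverseʳ f) ⟨
  f * ℚ.1/ f * (c * q * ℚ.1/ p)    ≡⟨ regroup f (ℚ.1/ f) c q (ℚ.1/ p) ⟩
  f * q * ℚ.1/ p * (c * ℚ.1/ f)    ≡⟨ cong₂ _*_ (÷'≡*1/ (f * q) p) (÷'≡*1/ c f) ⟨
  ((f * q) ÷' p) * (c ÷' f)        ∎
  where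
  open ℚSolver
  regroup : ∀ a b c d e → a * b * (c * d * e) ≡ a * d * e * (c * b)
  regroup = solve 5 (λ a b c d e → a :* b :* (c :* d :* e) := a :* d :* e :* (c :* b)) refl

toℚℤ-quotient : ∀ x p c q f .{{_ : ℤ.NonZero p}} .{{_ : ℤ.NonZero f}} → x ℤ.* p ≡ c ℤ.* q →
                toℚℤ x ≡ (toℚℤ (f ℤ.* q) ÷' toℚℤ p) * (toℚℤ c ÷' toℚℤ f)
toℚℤ-quotient x p c q f xp≡cq = begin
  toℚℤ x
    ≡⟨ ≡-÷'-* (toℚℤ x) (toℚℤ p) (toℚℤ c) (toℚℤ q) (toℚℤ f) {{toℚℤ-nonZero p}} {{toℚℤ-nonZero f}} cast ⟩
  ((toℚℤ f * toℚℤ q) ÷' toℚℤ p) * (toℚℤ c ÷' toℚℤ f)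
    ≡⟨ cong (λ y → (y ÷' toℚℤ p) * (toℚℤ c ÷' toℚℤ f)) (toℚℤ-* f q) ⟨
  (toℚℤ (f ℤ.* q) ÷' toℚℤ p) * (toℚℤ c ÷' toℚℤ f) ∎
  where
  cast : toℚℤ x * toℚℤ p ≡ toℚℤ c * toℚℤ q
  cast = trans (sym (toℚℤ-* x p)) (trans (cong toℚℤ xp≡cq) (toℚℤ-* c q))

-- The three cases of the theorem, for d = n + 2 and j = m + 1

module _ (n i m : ℕ) (m≤i : m ≤ i) where

  private
    I J : List ℕ
    I = range i (suc (suc n))
    J = 0 ∷ range (suc m) n

    lam : ℚ
    lam = toℚ (product (map (λ k → b (i + k) m) (upTo (suc n))))
          ÷' toℚ (product (map (λ k → b (m + k) m) (upTo n)))

    m≤i+t : ∀ t → m ≤ i + t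
    m≤i+t t = ℕP.≤-trans m≤i (ℕP.m≤m+n i t)

  det-Bin-ℚ : ∀ t → t ≤ n → toℚℤ (det n (Bin i m t)) ≡ lam * (toℚ (n C t) ÷' toℚ (b (i + t) m))
  det-Bin-ℚ t t≤n = begin
    toℚℤ (det n (Bin i m t))
      ≡⟨ toℚℤ-quotient (det n (Bin i m t)) P (+ (n C t)) Q f {{P-nonZero}} {{nCk-nonZero (m≤i+t t)}}
                       (det-Bin n m i t m≤i t≤n) ⟩
    (toℚℤ (f ℤ.* Q) ÷' toℚℤ P) * (toℚ (n C t) ÷' toℚℤ f)
      ≡⟨ cong (λ F → (toℚℤ F ÷' toℚℤ P) * (toℚ (n C t) ÷' toℚℤ f)) (Π-skip n t (λ k → + b (i + k) m) t≤n) ⟨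
    (toℚℤ (Π (suc n) (λ k → + b (i + k) m)) ÷' toℚℤ P) * (toℚ (n C t) ÷' toℚℤ f)
      ≡⟨ cong₂ (λ F P → (toℚℤ F ÷' toℚℤ P) * (toℚ (n C t) ÷' toℚℤ f))
               (+product≡Π (suc n) (λ k → b (i + k) m)) (+product≡Π n (λ k → b (m + k) m)) ⟨
    lam * (toℚ (n C t) ÷' toℚ (b (i + t) m)) ∎
    where
    P = Π n (λ k → + b (m + k) m)
    Q = Π n (λ k → + b (gapRange i t k) m)
    f = + b (i + t) m
    P-nonZero : ℤ.NonZero P
    P-nonZero = Π-nonZero n _ (λ k → nCk-nonZero (ℕP.m≤m+n m k))

  minor-gapFirst : toℚℤ (bMinor (remove I i) J) ≡ lam ÷' toℚ (b i m)
  minor-gapFirst = begin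
    toℚℤ (bMinor (remove I i) J)         ≡⟨ cong (λ x → toℚℤ (bMinor (remove I x) J)) (ℕP.+-identityʳ i) ⟨
    toℚℤ (bMinor (remove I (i + 0)) J)
      ≡⟨ cong toℚℤ (trans (bMinor-Bin₀ n i m 0 z≤n) (det-Bin₀-gapFirst n i m)) ⟩
    toℚℤ (det n (Bin i m 0))             ≡⟨ det-Bin-ℚ 0 z≤n ⟩
    lam * (ℚ.1ℚ ÷' toℚ (b (i + 0) m))    ≡⟨ cong (λ x → lam * (ℚ.1ℚ ÷' toℚ (b x m))) (ℕP.+-identityʳ i) ⟩
    lam * (ℚ.1ℚ ÷' toℚ (b i m))          ≡⟨ *-1÷' lam (toℚ (b i m)) {{toℚ-nCk-nonZero m≤i}} ⟩
    lam ÷' toℚ (b i m)                   ∎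

  minor-gapLast : toℚℤ (bMinor (remove I (i + suc (suc n) ∸ 1)) J)
                    ≡ lam ÷' toℚ (b (i + suc (suc n) ∸ 2) m)
  minor-gapLast = begin
    toℚℤ (bMinor (remove I (i + suc (suc n) ∸ 1)) J)
      ≡⟨ cong (λ x → toℚℤ (bMinor (remove I x) J)) (ℕP.+-∸-assoc i (s≤s z≤n)) ⟩
    toℚℤ (bMinor (remove I (i + suc n)) J)
      ≡⟨ cong toℚℤ (trans (bMinor-Bin₀ n i m (suc n) ℕP.≤-refl) (det-Bin₀-gapLast n i m)) ⟩
    toℚℤ (det n (Bin i m n))
      ≡⟨ det-Bin-ℚ n ℕP.≤-refl ⟩
    lam * (toℚ (n C n) ÷' toℚ (b (i + n) m))
      ≡⟨ cong (λ x → lam * (toℚ x ÷' toℚ (b (i + n) m))) (nCn≡1 n) ⟩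
    lam * (ℚ.1ℚ ÷' toℚ (b (i + n) m))
      ≡⟨ *-1÷' lam (toℚ (b (i + n) m)) {{toℚ-nCk-nonZero (m≤i+t n)}} ⟩
    lam ÷' toℚ (b (i + n) m)
      ≡⟨ cong (λ x → lam ÷' toℚ (b x m)) (ℕP.+-∸-assoc i (s≤s (s≤s z≤n))) ⟨
    lam ÷' toℚ (b (i + suc (suc n) ∸ 2) m) ∎

  minor-gapInside : ∀ r → 2 ≤ r → r ≤ suc n →
    toℚℤ (bMinor (remove I (i + r ∸ 1)) J)
      ≡ lam * ((toℚ (b n (r ∸ 1)) ÷' toℚ (b (i + r ∸ 1) m)) ℚ.+ (toℚ (b n (r ∸ 2)) ÷' toℚ (b (i + r ∸ 2) m)))
  minor-gapInside (suc (suc t)) (s≤s (s≤s _)) (s≤s t<n) = begin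
    toℚℤ (bMinor (remove I (i + suc (suc t) ∸ 1)) J)
      ≡⟨ cong (λ x → toℚℤ (bMinor (remove I x) J)) (ℕP.+-∸-assoc i (s≤s z≤n)) ⟩
    toℚℤ (bMinor (remove I (i + suc t)) J)
      ≡⟨ cong toℚℤ (trans (bMinor-Bin₀ n i m (suc t) (ℕP.m≤n⇒m≤1+n t<n)) (det-Bin₀-gapInside n i m t t<n)) ⟩
    toℚℤ (det n (Bin i m t) ℤ.+ det n (Bin i m (suc t)))
      ≡⟨ toℚℤ-+ (det n (Bin i m t)) (det n (Bin i m (suc t))) ⟩
    toℚℤ (det n (Bin i m t)) ℚ.+ toℚℤ (det n (Bin i m (suc t)))
      ≡⟨ cong₂ ℚ._+_ (det-Bin-ℚ t (ℕP.<⇒≤ t<n)) (det-Bin-ℚ (suc t) t<n) ⟩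
    lam * X t ℚ.+ lam * X (suc t)
      ≡⟨ ℚP.*-distribˡ-+ lam (X t) (X (suc t)) ⟨
    lam * (X t ℚ.+ X (suc t))
      ≡⟨ cong (lam *_) (ℚP.+-comm (X t) (X (suc t))) ⟩
    lam * (X (suc t) ℚ.+ X t)
      ≡⟨ cong₂ (λ x y → lam * ((toℚ (b n (suc t)) ÷' toℚ (b x m)) ℚ.+ (toℚ (b n t) ÷' toℚ (b y m))))
               (ℕP.+-∸-assoc i (s≤s z≤n)) (ℕP.+-∸-assoc i (s≤s (s≤s z≤n))) ⟨
    lam * ((toℚ (b n (suc t)) ÷' toℚ (b (i + suc (suc t) ∸ 1) m))
             ℚ.+ (toℚ (b n t) ÷' toℚ (b (i + suc (suc t) ∸ 2) m))) ∎
    where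
    X : ℕ → ℚ
    X k = toℚ (n C k) ÷' toℚ (b (i + k) m)

theorem7p1 : (d i j : ℕ) → 3 ≤ d → 1 ≤ j →
    (0 ∷ range j (d ∸ 2)) ≤ˢ remove (range i d) (i + d ∸ 1) →
    let I = range i d
        J = 0 ∷ range j (d ∸ 2)
        lam = toℚ (product (map (λ k → b (i + k) (j ∸ 1)) (upTo (d ∸ 1))))
              ÷' toℚ (product (map (λ k → b (j ∸ 1 + k) (j ∸ 1)) (upTo (d ∸ 2))))
    in ((r : ℕ) → 2 ≤ r → r ≤ d ∸ 1 →
          toℚℤ (bMinor (remove I (i + r ∸ 1)) J)
            ≡ lam * ((toℚ (b (d ∸ 2) (r ∸ 1)) ÷' toℚ (b (i + r ∸ 1) (j ∸ 1)))
                     Data.Rational.+ (toℚ (b (d ∸ 2) (r ∸ 2)) ÷' toℚ (b (i + r ∸ 2) (j ∸ 1)))))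
       × (toℚℤ (bMinor (remove I i) J) ≡ lam ÷' toℚ (b i (j ∸ 1)))
       × (toℚℤ (bMinor (remove I (i + d ∸ 1)) J) ≡ lam ÷' toℚ (b (i + d ∸ 2) (j ∸ 1)))
theorem7p1 (suc (suc (suc n))) i (suc m) (s≤s (s≤s (s≤s _))) (s≤s _) J≤I =
  minor-gapInside (suc n) i m m≤i , minor-gapFirst (suc n) i m m≤i , minor-gapLast (suc n) i m m≤i
  where
  m≤i : m ≤ i
  m≤i = ≤ˢ-gapLast⇒c≤a n i m J≤I
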